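{- Consider chip configurations $z=(z_0,\dots,z_4)\in\mathbb Z[i]^5$ on nodes $v_0,\dots,v_4$ (indices mod $5$) modulo firing equivalence $z\sim z'\iff z-z'\in\overline{\mathcal K}\,\mathbb Z[i]^5$, where \[\overline{\mathcal K}=\begin{bmatrix} 1 + i & -i & 0 & 0 & -i \\ -i & 1 + i & -i & 0 & 0 \\ 0 & -i & 1 + i & -i & 0 \\ 0 & 0 & -i & 1 + i & -i \\ -i & 0 & 0 & -i & 1 + i \end{bmatrix},\] and fix a distinguished node $v_d$. Given an input $z$, perform: (1) let $\psi_k=\operatorname{Im}z_k$; (2)–(3) replace $z$ by the real configuration $x\in\mathbb Z^5$ with $x_k=\operatorname{Re}z_k+\psi_k-\psi_{k+1}-\psi_{k-1}$; (4)–(5) record whether $\sum_k x_k$ is even; (6) replace $x$ by $y$ with $y_k=x_k-x_d$ for all $k$; (7) replace each $y_k$ by its remainder $r_k\in\{0,1,2\}$ upon division by $3$; (8) if the parity of $\sum_k r_k$ differs from the parity recorded in step (5), add $3$ to $r_d$. Then the output $r$ is firing equivalent to the input $z$, and $r$ has no imaginary chips, $r_d\in\{0,3\}$, and $r_k\in\{0,1,2\}$ for all $k\ne d$; that is, $r$ is the unique configuration of this form in the firing equivalence class of $z$.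
   Context: For a configuration $z$, node $v_k$ carries $\operatorname{Re}z_k$ real and $\operatorname{Im}z_k$ imaginary chips. The group of firing equivalence classes is isomorphic to the sandpile group of the regular matroid $R_{10}$, of order $162$. -}

module Defs where

open import Data.Nat as ℕ using (ℕ)
open import Data.Integer using (ℤ; +_; _+_; _-_; _*_; -_; _%ℕ_)
open import Data.Fin using (Fin; zero; suc; _≟_)
open import Data.Product using (_×_; _,_; proj₁; proj₂; Σ)
open import Data.Sum using (_⊎_)
open import Relation.Nullary using (yes; no; ¬_)
open import Relation.Binary.PropositionalEquality using (_≡_)

GI : Set
GI = ℤ × ℤ

re im : GI → ℤ
re = proj₁
im = proj₂

_+ᵍ_ : GI → GI → GI
(a , b) +ᵍ (c , d) = (a + c , b + d)

_-ᵍ_ : GI → GI → GI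
(a , b) -ᵍ (c , d) = (a - c , b - d)

_*ᵍ_ : GI → GI → GI
(a , b) *ᵍ (c , d) = (a * c - b * d , a * d + b * c)

0ᵍ : GI
0ᵍ = (+ 0 , + 0)

Config : Set
Config = Fin 5 → GI

next : Fin 5 → Fin 5
next zero = suc zero
next (suc zero) = suc (suc zero)
next (suc (suc zero)) = suc (suc (suc zero))
next (suc (suc (suc zero))) = suc (suc (suc (suc zero)))
next (suc (suc (suc (suc zero)))) = zero

prev : Fin 5 → Fin 5
prev zero = suc (suc (suc (suc zero)))
prev (suc zero) = zero
prev (suc (suc zero)) = suc zero
prev (suc (suc (suc zero))) = suc (suc zero)
prev (suc (suc (suc (suc zero)))) = suc (suc (suc zero))

Kbar : Fin 5 → Fin 5 → GI
Kbar k j with k ≟ j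
... | yes _ = (+ 1 , + 1)
... | no _ with j ≟ next k
...   | yes _ = (+ 0 , - (+ 1))
...   | no _ with j ≟ prev k
...     | yes _ = (+ 0 , - (+ 1))
...     | no _ = 0ᵍ

sum5ᵍ : (Fin 5 → GI) → GI
sum5ᵍ f = f zero +ᵍ (f (suc zero) +ᵍ (f (suc (suc zero)) +ᵍ
          (f (suc (suc (suc zero))) +ᵍ f (suc (suc (suc (suc zero)))))))

sum5 : (Fin 5 → ℤ) → ℤ
sum5 f = f zero + (f (suc zero) + (f (suc (suc zero)) +
          (f (suc (suc (suc zero))) + f (suc (suc (suc (suc zero)))))))

applyK : Config → Config
applyK w k = sum5ᵍ (λ j → Kbar k j *ᵍ w j)

FiringEquiv : Config → Config → Set
FiringEquiv z z' = Σ Config (λ w → ∀ k → (z k -ᵍ z' k) ≡ applyK w k)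

algorithm : Fin 5 → Config → Config
algorithm d z = λ k → (+ out k , + 0)
  where
  ψ : Fin 5 → ℤ
  ψ k = im (z k)
  x : Fin 5 → ℤ
  x k = re (z k) + ψ k - ψ (next k) - ψ (prev k)
  parX : ℕ
  parX = sum5 x %ℕ 2
  y : Fin 5 → ℤ
  y k = x k - x d
  r : Fin 5 → ℕ
  r k = y k %ℕ 3
  parR : ℕ
  parR = sum5 (λ k → + r k) %ℕ 2
  out : Fin 5 → ℕ
  out k with parR ℕ.≟ parX | k ≟ d
  ... | no _  | yes _ = r k ℕ.+ 3
  ... | _     | _     = r k

Reduced : Fin 5 → Config → Set
Reduced d r =
  (∀ k → im (r k) ≡ + 0) ×
  (re (r d) ≡ + 0 ⊎ re (r d) ≡ + 3) ×
  (∀ k → ¬ (k ≡ d) → (re (r k) ≡ + 0 ⊎ re (r k) ≡ + 1 ⊎ re (r k) ≡ + 2))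

-- Put X(z)_k = Re z_k + Im z_k − Im z_{k+1} − Im z_{k−1}; firing −i·Im z shows z ∼ X(z), so everything
-- happens on real configurations. There the firing lattice is exactly the set of "balanced" e ∈ ℤ⁵:
-- all e_k congruent mod 3 and Σ e even. Indeed every firing w gives
-- X(K̄w)_k = Σ Re w + 3 (Re w_k − Re w_{k+1} − Re w_{k−1}), and conversely a suitable firing realises
-- 3u − (Σ u) for any u ∈ ℤ⁵, which reaches every balanced vector. Steps (6)–(8) change x = X(z) by a
-- balanced vector (step (8) repairs the parity), so the output is equivalent to z. Two reduced
-- configurations with balanced difference agree: off d their digits are congruent mod 3, and at d,
-- where both values lie in {0, 3}, parity decides.

module Submission where

open import Defs
open import Data.Fin using (Fin; _≟_)
open import Data.Fin.Patterns using (0F; 1F; 2F; 3F; 4F)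
open import Data.Nat as ℕ using (ℕ; NonZero; s≤s)
open import Data.Integer using (ℤ; +_; _+_; _-_; _*_; -_; _%ℕ_; _/ℕ_)
open import Data.Integer.Properties using (+-identityʳ; +-inverseʳ)
open import Data.Integer.DivMod using (a≡a%ℕn+[a/ℕn]*n; n%ℕd<d)
open import Data.Integer.Divisibility.Signed using (_∣_; divides; quotient; _∣?_; ∣m∣n⇒∣m+n)
open import Data.Integer.Tactic.RingSolver using (solve-∀)
open import Data.Product using (Σ; _×_; _,_)
open import Data.Sum using (_⊎_; inj₁; inj₂)
open import Function using (_∘_)
open import Relation.Nullary using (¬_; yes; no; contradiction)
open import Relation.Nullary.Decidable using (False; toWitnessFalse)
open import Relation.Binary.PropositionalEquality
  using (_≡_; _≢_; refl; sym; trans; cong; cong₂; subst; module ≡-Reasoning)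

prev-next : ∀ k → prev (next k) ≡ k
prev-next 0F = refl
prev-next 1F = refl
prev-next 2F = refl
prev-next 3F = refl
prev-next 4F = refl

next-prev : ∀ k → next (prev k) ≡ k
next-prev 0F = refl
next-prev 1F = refl
next-prev 2F = refl
next-prev 3F = refl
next-prev 4F = refl

next³≡prev² : ∀ k → next (next (next k)) ≡ prev (prev k)
next³≡prev² 0F = refl
next³≡prev² 1F = refl
next³≡prev² 2F = refl
next³≡prev² 3F = refl
next³≡prev² 4F = refl

prev³≡next² : ∀ k → prev (prev (prev k)) ≡ next (next k)
prev³≡next² 0F = refl
prev³≡next² 1F = refl
prev³≡next² 2F = refl
prev³≡next² 3F = refl
prev³≡next² 4F = refl

neighbours-≢ : ∀ d → next d ≢ d × prev d ≢ d × next (next d) ≢ d × prev (prev d) ≢ d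
neighbours-≢ 0F = (λ ()) , (λ ()) , (λ ()) , (λ ())
neighbours-≢ 1F = (λ ()) , (λ ()) , (λ ()) , (λ ())
neighbours-≢ 2F = (λ ()) , (λ ()) , (λ ()) , (λ ())
neighbours-≢ 3F = (λ ()) , (λ ()) , (λ ()) , (λ ())
neighbours-≢ 4F = (λ ()) , (λ ()) , (λ ()) , (λ ())

sum5-∘next : ∀ f → sum5 (f ∘ next) ≡ sum5 f
sum5-∘next f = rotate (f 0F) (f 1F) (f 2F) (f 3F) (f 4F)
  where
  rotate : ∀ a b c d e → b + (c + (d + (e + a))) ≡ a + (b + (c + (d + e)))
  rotate = solve-∀

sum5-∘prev : ∀ f → sum5 (f ∘ prev) ≡ sum5 f
sum5-∘prev f = sym (sum5-∘next (f ∘ prev))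

sum5-around : ∀ f k →
  f k + (f (next k) + (f (prev k) + (f (next (next k)) + f (prev (prev k))))) ≡ sum5 f
sum5-around f 0F = reorder (f 0F) (f 1F) (f 2F) (f 3F) (f 4F)
  where
  reorder : ∀ a b c d e → a + (b + (e + (c + d))) ≡ a + (b + (c + (d + e)))
  reorder = solve-∀
sum5-around f 1F = trans (sum5-around (f ∘ next) 0F) (sum5-∘next f)
sum5-around f 2F =
  trans (sum5-around (f ∘ next ∘ next) 0F) (trans (sum5-∘next (f ∘ next)) (sum5-∘next f))
sum5-around f 3F =
  trans (sum5-around (f ∘ prev ∘ prev) 0F) (trans (sum5-∘prev (f ∘ prev)) (sum5-∘prev f))
sum5-around f 4F = trans (sum5-around (f ∘ prev) 0F) (sum5-∘prev f)

sum5-cong : ∀ {f g} → (∀ k → f k ≡ g k) → sum5 f ≡ sum5 g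
sum5-cong f≡g =
  cong₂ _+_ (f≡g 0F) (cong₂ _+_ (f≡g 1F) (cong₂ _+_ (f≡g 2F) (cong₂ _+_ (f≡g 3F) (f≡g 4F))))

sum5-+ : ∀ f g → sum5 (λ k → f k + g k) ≡ sum5 f + sum5 g
sum5-+ f g = identity (f 0F) (f 1F) (f 2F) (f 3F) (f 4F) (g 0F) (g 1F) (g 2F) (g 3F) (g 4F)
  where
  identity : ∀ a₀ a₁ a₂ a₃ a₄ b₀ b₁ b₂ b₃ b₄ →
    (a₀ + b₀) + ((a₁ + b₁) + ((a₂ + b₂) + ((a₃ + b₃) + (a₄ + b₄))))
    ≡ (a₀ + (a₁ + (a₂ + (a₃ + a₄)))) + (b₀ + (b₁ + (b₂ + (b₃ + b₄))))
  identity = solve-∀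

sum5-- : ∀ f g → sum5 (λ k → f k - g k) ≡ sum5 f - sum5 g
sum5-- f g = identity (f 0F) (f 1F) (f 2F) (f 3F) (f 4F) (g 0F) (g 1F) (g 2F) (g 3F) (g 4F)
  where
  identity : ∀ a₀ a₁ a₂ a₃ a₄ b₀ b₁ b₂ b₃ b₄ →
    (a₀ - b₀) + ((a₁ - b₁) + ((a₂ - b₂) + ((a₃ - b₃) + (a₄ - b₄))))
    ≡ (a₀ + (a₁ + (a₂ + (a₃ + a₄)))) - (b₀ + (b₁ + (b₂ + (b₃ + b₄))))
  identity = solve-∀

sum5-* : ∀ c f → sum5 (λ k → c * f k) ≡ c * sum5 f
sum5-* c f = identity c (f 0F) (f 1F) (f 2F) (f 3F) (f 4F)
  where
  identity : ∀ c a₀ a₁ a₂ a₃ a₄ →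
    c * a₀ + (c * a₁ + (c * a₂ + (c * a₃ + c * a₄))) ≡ c * (a₀ + (a₁ + (a₂ + (a₃ + a₄))))
  identity = solve-∀

sum5-const : ∀ c → sum5 (λ _ → c) ≡ + 5 * c
sum5-const c = identity c
  where
  identity : ∀ c → c + (c + (c + (c + c))) ≡ + 5 * c
  identity = solve-∀

sum5-affine : ∀ a t → sum5 (λ k → a + + 3 * t k) ≡ + 5 * a + + 3 * sum5 t
sum5-affine a t = trans (sum5-+ (λ _ → a) (λ k → + 3 * t k)) (cong₂ _+_ (sum5-const a) (sum5-* (+ 3) t))

sum5-minus-neighbours : ∀ f → sum5 (λ k → f k - f (next k) - f (prev k)) ≡ - sum5 f
sum5-minus-neighbours f = identity (f 0F) (f 1F) (f 2F) (f 3F) (f 4F)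
  where
  identity : ∀ a₀ a₁ a₂ a₃ a₄ →
    (a₀ - a₁ - a₄) + ((a₁ - a₂ - a₀) + ((a₂ - a₃ - a₁) + ((a₃ - a₄ - a₂) + (a₄ - a₀ - a₃))))
    ≡ - (a₀ + (a₁ + (a₂ + (a₃ + a₄))))
  identity = solve-∀

sum5-supported : ∀ d e → (∀ k → k ≢ d → e k ≡ + 0) → sum5 e ≡ e d
sum5-supported d e e-off with neighbours-≢ d
... | n≢d , p≢d , nn≢d , pp≢d = begin
    sum5 e
  ≡⟨ sum5-around e d ⟨
    e d + (e (next d) + (e (prev d) + (e (next (next d)) + e (prev (prev d)))))
  ≡⟨ cong (_+_ (e d)) (cong₂ _+_ (e-off _ n≢d) (cong₂ _+_ (e-off _ p≢d)
                   (cong₂ _+_ (e-off _ nn≢d) (e-off _ pp≢d)))) ⟩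
    e d + + 0
  ≡⟨ +-identityʳ (e d) ⟩
    e d
  ∎
  where open ≡-Reasoning

1+i : GI
1+i = (+ 1 , + 1)

-i : GI
-i = (+ 0 , - + 1)

-- (1 + i) u − i u₊ − i u₋, one row of K̄.
stencil : GI → GI → GI → GI
stencil (a , b) (a₊ , b₊) (a₋ , b₋) = (a - b + b₊ + b₋ , a + b - a₊ - a₋)

Kbar-row : ∀ k → Kbar k k ≡ 1+i × Kbar k (next k) ≡ -i × Kbar k (prev k) ≡ -i
                 × Kbar k (next (next k)) ≡ 0ᵍ × Kbar k (prev (prev k)) ≡ 0ᵍ
Kbar-row 0F = refl , refl , refl , refl , refl
Kbar-row 1F = refl , refl , refl , refl , refl
Kbar-row 2F = refl , refl , refl , refl , refl
Kbar-row 3F = refl , refl , refl , refl , refl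
Kbar-row 4F = refl , refl , refl , refl , refl

applyK-stencil : ∀ w k → applyK w k ≡ stencil (w k) (w (next k)) (w (prev k))
applyK-stencil w k =
  trans (sym (sum5ᵍ-around (λ j → Kbar k j *ᵍ w j) k))
        (row (Kbar-row k) (w k) (w (next k)) (w (prev k)) (w (next (next k))) (w (prev (prev k))))
  where
  sum5ᵍ-around : ∀ f k →
    f k +ᵍ (f (next k) +ᵍ (f (prev k) +ᵍ (f (next (next k)) +ᵍ f (prev (prev k))))) ≡ sum5ᵍ f
  sum5ᵍ-around f k = cong₂ _,_ (sum5-around (re ∘ f) k) (sum5-around (im ∘ f) k)
  row : ∀ {c c₊ c₋ c₊₊ c₋₋} → c ≡ 1+i × c₊ ≡ -i × c₋ ≡ -i × c₊₊ ≡ 0ᵍ × c₋₋ ≡ 0ᵍ →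
    ∀ u u₊ u₋ u₊₊ u₋₋ →
    (c *ᵍ u) +ᵍ ((c₊ *ᵍ u₊) +ᵍ ((c₋ *ᵍ u₋) +ᵍ ((c₊₊ *ᵍ u₊₊) +ᵍ (c₋₋ *ᵍ u₋₋)))) ≡ stencil u u₊ u₋
  row (refl , refl , refl , refl , refl) (a , b) (a₊ , b₊) (a₋ , b₋) (a₊₊ , b₊₊) (a₋₋ , b₋₋) =
    cong₂ _,_ (row-re a b a₊ b₊ a₋ b₋ a₊₊ b₊₊ a₋₋ b₋₋) (row-im a b a₊ b₊ a₋ b₋ a₊₊ b₊₊ a₋₋ b₋₋)
    where
    row-re : ∀ a b a₊ b₊ a₋ b₋ a₊₊ b₊₊ a₋₋ b₋₋ →
      (+ 1 * a - + 1 * b) + ((+ 0 * a₊ - - + 1 * b₊) + ((+ 0 * a₋ - - + 1 * b₋)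
        + ((+ 0 * a₊₊ - + 0 * b₊₊) + (+ 0 * a₋₋ - + 0 * b₋₋))))
      ≡ a - b + b₊ + b₋
    row-re = solve-∀
    row-im : ∀ a b a₊ b₊ a₋ b₋ a₊₊ b₊₊ a₋₋ b₋₋ →
      (+ 1 * b + + 1 * a) + ((+ 0 * b₊ + - + 1 * a₊) + ((+ 0 * b₋ + - + 1 * a₋)
        + ((+ 0 * b₊₊ + + 0 * a₊₊) + (+ 0 * b₋₋ + + 0 * a₋₋))))
      ≡ a + b - a₊ - a₋
    row-im = solve-∀

_-ᶜ_ : Config → Config → Config
(w -ᶜ w') k = w k -ᵍ w' k

applyK-- : ∀ w w' k → applyK (w -ᶜ w') k ≡ applyK w k -ᵍ applyK w' k
applyK-- w w' k = begin
    applyK (w -ᶜ w') k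
  ≡⟨ applyK-stencil (w -ᶜ w') k ⟩
    stencil (w k -ᵍ w' k) (w (next k) -ᵍ w' (next k)) (w (prev k) -ᵍ w' (prev k))
  ≡⟨ stencil-- (w k) (w (next k)) (w (prev k)) (w' k) (w' (next k)) (w' (prev k)) ⟩
    stencil (w k) (w (next k)) (w (prev k)) -ᵍ stencil (w' k) (w' (next k)) (w' (prev k))
  ≡⟨ cong₂ _-ᵍ_ (applyK-stencil w k) (applyK-stencil w' k) ⟨
    applyK w k -ᵍ applyK w' k
  ∎
  where
  open ≡-Reasoning
  stencil-- : ∀ u u₊ u₋ v v₊ v₋ →
    stencil (u -ᵍ v) (u₊ -ᵍ v₊) (u₋ -ᵍ v₋) ≡ stencil u u₊ u₋ -ᵍ stencil v v₊ v₋
  stencil-- (a , b) (a₊ , b₊) (a₋ , b₋) (c , d) (c₊ , d₊) (c₋ , d₋) =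
    cong₂ _,_ (re-- a b b₊ b₋ c d d₊ d₋) (im-- b a a₊ a₋ d c c₊ c₋)
    where
    re-- : ∀ a b b₊ b₋ c d d₊ d₋ →
      (a - c) - (b - d) + (b₊ - d₊) + (b₋ - d₋) ≡ (a - b + b₊ + b₋) - (c - d + d₊ + d₋)
    re-- = solve-∀
    im-- : ∀ b a a₊ a₋ d c c₊ c₋ →
      (a - c) + (b - d) - (a₊ - c₊) - (a₋ - c₋) ≡ (a + b - a₊ - a₋) - (c + d - c₊ - c₋)
    im-- = solve-∀

Fired : Config → Set
Fired c = Σ Config λ w → ∀ k → c k ≡ applyK w k

FiringEquiv-euclidean : ∀ {r r' z} → FiringEquiv r z → FiringEquiv r' z → FiringEquiv r r'
FiringEquiv-euclidean {r} {r'} {z} (w , r∼z) (w' , r'∼z) = w -ᶜ w' , λ k → begin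
    r k -ᵍ r' k
  ≡⟨ via (r k) (r' k) (z k) ⟩
    (r k -ᵍ z k) -ᵍ (r' k -ᵍ z k)
  ≡⟨ cong₂ _-ᵍ_ (r∼z k) (r'∼z k) ⟩
    applyK w k -ᵍ applyK w' k
  ≡⟨ applyK-- w w' k ⟨
    applyK (w -ᶜ w') k
  ∎
  where
  open ≡-Reasoning
  via : ∀ u v s → u -ᵍ v ≡ (u -ᵍ s) -ᵍ (v -ᵍ s)
  via (a , b) (c , d) (e , f) = cong₂ _,_ (identity a c e) (identity b d f)
    where
    identity : ∀ a c e → a - c ≡ (a - e) - (c - e)
    identity = solve-∀

realify : Config → Fin 5 → ℤ
realify z k = re (z k) + im (z k) - im (z (next k)) - im (z (prev k))

realConfig : (Fin 5 → ℤ) → Config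
realConfig e k = (e k , + 0)

realify-cong : ∀ {c c'} → (∀ j → c j ≡ c' j) → ∀ k → realify c k ≡ realify c' k
realify-cong c≡c' k = cong₂ _-_ (cong₂ _-_ (cong₂ _+_ (cong re (c≡c' k)) (cong im (c≡c' k)))
                                           (cong im (c≡c' (next k))))
                                (cong im (c≡c' (prev k)))

realify-real : ∀ {c} → (∀ k → im (c k) ≡ + 0) → ∀ k → realify c k ≡ re (c k)
realify-real {c} c-real k =
  trans (cong₂ _-_ (cong₂ _-_ (cong (_+_ (re (c k))) (c-real k)) (c-real (next k))) (c-real (prev k)))
        (identity (re (c k)))
  where
  identity : ∀ a → a + + 0 - + 0 - + 0 ≡ a
  identity = solve-∀

realify-applyK : ∀ w k →
  realify (applyK w) k ≡ sum5 (re ∘ w) + + 3 * (re (w k) - re (w (next k)) - re (w (prev k)))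
realify-applyK w k = begin
    realify (applyK w) k
  ≡⟨ realify-cong (applyK-stencil w) k ⟩
    realify (λ j → stencil (w j) (w (next j)) (w (prev j))) k
  ≡⟨ realify-stencil (w k) (w (next k)) (w (prev k)) (w (next (next k))) (w (prev (prev k)))
           (cong w (prev-next k)) (cong w (next-prev k)) ⟩
    (re (w k) + (re (w (next k)) + (re (w (prev k))
      + (re (w (next (next k))) + re (w (prev (prev k)))))))
      + + 3 * (re (w k) - re (w (next k)) - re (w (prev k)))
  ≡⟨ cong (_+ + 3 * (re (w k) - re (w (next k)) - re (w (prev k)))) (sum5-around (re ∘ w) k) ⟩
    sum5 (re ∘ w) + + 3 * (re (w k) - re (w (next k)) - re (w (prev k)))
  ∎
  where
  open ≡-Reasoning
  realify-stencil : ∀ u u₊ u₋ u₊₊ u₋₋ {u₊₋ u₋₊} → u₊₋ ≡ u → u₋₊ ≡ u →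
    re (stencil u u₊ u₋) + im (stencil u u₊ u₋)
      - im (stencil u₊ u₊₊ u₊₋) - im (stencil u₋ u₋₊ u₋₋)
    ≡ (re u + (re u₊ + (re u₋ + (re u₊₊ + re u₋₋)))) + + 3 * (re u - re u₊ - re u₋)
  realify-stencil (a , b) (a₊ , b₊) (a₋ , b₋) (a₊₊ , _) (a₋₋ , _) refl refl =
    identity a b a₊ b₊ a₋ b₋ a₊₊ a₋₋
    where
    identity : ∀ a b a₊ b₊ a₋ b₋ a₊₊ a₋₋ →
      (a - b + b₊ + b₋) + (a + b - a₊ - a₋) - (a₊ + b₊ - a₊₊ - a) - (a₋ + b₋ - a - a₋₋)
      ≡ (a + (a₊ + (a₋ + (a₊₊ + a₋₋)))) + + 3 * (a - a₊ - a₋)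
    identity = solve-∀

applyK-imaginary : ∀ z k → applyK (λ j → (+ 0 , im (z j))) k ≡ z k -ᵍ realConfig (realify z) k
applyK-imaginary z k = trans (applyK-stencil (λ j → (+ 0 , im (z j))) k)
  (cong₂ _,_ (identity-re (re (z k)) (im (z k)) (im (z (next k))) (im (z (prev k))))
             (identity-im (im (z k))))
  where
  identity-re : ∀ a b b₊ b₋ → + 0 - b + b₊ + b₋ ≡ a - (a + b - b₊ - b₋)
  identity-re = solve-∀
  identity-im : ∀ b → + 0 + b - + 0 - + 0 ≡ b - + 0
  identity-im = solve-∀

-- Its real part is (I − S² − S⁻²) u, which inverts I − S − S⁻¹ on the 5-cycle (S the shift k ↦ k + 1).
tripleFiring : (Fin 5 → ℤ) → Config
tripleFiring u k = (u k - u (next (next k)) - u (prev (prev k)) , - u k)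

applyK-tripleFiring : ∀ u k → applyK (tripleFiring u) k ≡ realConfig (λ j → + 3 * u j - sum5 u) k
applyK-tripleFiring u k = begin
    applyK (tripleFiring u) k
  ≡⟨ applyK-stencil (tripleFiring u) k ⟩
    stencil (tripleFiring u k) (tripleFiring u (next k)) (tripleFiring u (prev k))
  ≡⟨ stencil-tripleFiring (u k) (u (next k)) (u (prev k)) (u (next (next k))) (u (prev (prev k)))
           (cong u (next³≡prev² k)) (cong (u ∘ prev) (prev-next k))
           (cong (u ∘ next) (next-prev k)) (cong u (prev³≡next² k)) ⟩
    (+ 3 * u k - (u k + (u (next k) + (u (prev k) + (u (next (next k)) + u (prev (prev k)))))) ,
     + 0)
  ≡⟨ cong (λ s → (+ 3 * u k - s , + 0)) (sum5-around u k) ⟩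
    realConfig (λ j → + 3 * u j - sum5 u) k
  ∎
  where
  open ≡-Reasoning
  stencil-tripleFiring : ∀ a a₊ a₋ a₊₊ a₋₋ {a₊₊₊ a₊₋₋ a₋₊₊ a₋₋₋} →
    a₊₊₊ ≡ a₋₋ → a₊₋₋ ≡ a₋ → a₋₊₊ ≡ a₊ → a₋₋₋ ≡ a₊₊ →
    stencil (a - a₊₊ - a₋₋ , - a) (a₊ - a₊₊₊ - a₊₋₋ , - a₊) (a₋ - a₋₊₊ - a₋₋₋ , - a₋)
    ≡ (+ 3 * a - (a + (a₊ + (a₋ + (a₊₊ + a₋₋)))) , + 0)
  stencil-tripleFiring a a₊ a₋ a₊₊ a₋₋ refl refl refl refl =
    cong₂ _,_ (identity-re a a₊ a₋ a₊₊ a₋₋) (identity-im a a₊ a₋ a₊₊ a₋₋)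
    where
    identity-re : ∀ a a₊ a₋ a₊₊ a₋₋ →
      (a - a₊₊ - a₋₋) - - a + - a₊ + - a₋ ≡ + 3 * a - (a + (a₊ + (a₋ + (a₊₊ + a₋₋))))
    identity-re = solve-∀
    identity-im : ∀ a a₊ a₋ a₊₊ a₋₋ →
      (a - a₊₊ - a₋₋) + - a - (a₊ - a₋₋ - a₋) - (a₋ - a₊ - a₊₊) ≡ + 0
    identity-im = solve-∀

record Balanced (e : Fin 5 → ℤ) : Set where
  field
    base  : ℤ
    steps : Fin 5 → ℤ
    split : ∀ k → e k ≡ base + + 3 * steps k
    even  : + 2 ∣ sum5 e

  mod3 : ∀ k j → + 3 ∣ e k - e j
  mod3 k j = divides (steps k - steps j) (begin
      e k - e j
    ≡⟨ cong₂ _-_ (split k) (split j) ⟩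
      (base + + 3 * steps k) - (base + + 3 * steps j)
    ≡⟨ identity base (steps k) (steps j) ⟩
      (steps k - steps j) * + 3
    ∎)
    where
    open ≡-Reasoning
    identity : ∀ a s t → (a + + 3 * s) - (a + + 3 * t) ≡ (s - t) * + 3
    identity = solve-∀

fired-real⇒balanced : ∀ {e} → Fired (realConfig e) → Balanced e
fired-real⇒balanced {e} (w , e≡Kw) = record
  { base  = sum5 (re ∘ w)
  ; steps = λ k → re (w k) - re (w (next k)) - re (w (prev k))
  ; split = split
  ; even  = divides (sum5 (re ∘ w)) (begin
      sum5 e
    ≡⟨ sum5-cong split ⟩
      sum5 (λ k → sum5 (re ∘ w) + + 3 * (re (w k) - re (w (next k)) - re (w (prev k))))
    ≡⟨ sum5-affine (sum5 (re ∘ w)) (λ k → re (w k) - re (w (next k)) - re (w (prev k))) ⟩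
      + 5 * sum5 (re ∘ w) + + 3 * sum5 (λ k → re (w k) - re (w (next k)) - re (w (prev k)))
    ≡⟨ cong (λ t → + 5 * sum5 (re ∘ w) + + 3 * t) (sum5-minus-neighbours (re ∘ w)) ⟩
      + 5 * sum5 (re ∘ w) + + 3 * - sum5 (re ∘ w)
    ≡⟨ identity (sum5 (re ∘ w)) ⟩
      sum5 (re ∘ w) * + 2
    ∎)
  }
  where
  open ≡-Reasoning
  identity : ∀ s → + 5 * s + + 3 * - s ≡ s * + 2
  identity = solve-∀
  Kw-real : ∀ k → im (applyK w k) ≡ + 0
  Kw-real k = sym (cong im (e≡Kw k))
  split : ∀ k → e k ≡ sum5 (re ∘ w) + + 3 * (re (w k) - re (w (next k)) - re (w (prev k)))
  split k = begin
      e k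
    ≡⟨ cong re (e≡Kw k) ⟩
      re (applyK w k)
    ≡⟨ realify-real {applyK w} Kw-real k ⟨
      realify (applyK w) k
    ≡⟨ realify-applyK w k ⟩
      sum5 (re ∘ w) + + 3 * (re (w k) - re (w (next k)) - re (w (prev k)))
    ∎

balanced⇒fired-real : ∀ {e} → Balanced e → Fired (realConfig e)
balanced⇒fired-real {e} b =
  tripleFiring u , λ k → trans (cong (λ v → (v , + 0)) (sym (Ku≡e k))) (sym (applyK-tripleFiring u k))
  where
  open Balanced b
  open ≡-Reasoning
  q : ℤ
  q = quotient even
  2q≡Σe : q * + 2 ≡ + 5 * base + + 3 * sum5 steps
  2q≡Σe = trans (sym (_∣_.equality even)) (trans (sum5-cong split) (sum5-affine base steps))
  -- m = −(base + Σ steps) / 2, an integer because Σ e = 5 base + 3 Σ steps is even.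
  m : ℤ
  m = + 2 * base + sum5 steps - q
  u : Fin 5 → ℤ
  u k = m + steps k
  Ku≡e : ∀ k → + 3 * u k - sum5 u ≡ e k
  Ku≡e k = begin
      + 3 * u k - sum5 u
    ≡⟨ cong (λ s → + 3 * u k - s)
            (trans (sum5-+ (λ _ → m) steps) (cong (_+ sum5 steps) (sum5-const m))) ⟩
      + 3 * (m + steps k) - (+ 5 * m + sum5 steps)
    ≡⟨ identity₁ base (sum5 steps) q (steps k) ⟩
      q * + 2 - (+ 4 * base + + 3 * sum5 steps) + + 3 * steps k
    ≡⟨ cong (λ s → s - (+ 4 * base + + 3 * sum5 steps) + + 3 * steps k) 2q≡Σe ⟩
      (+ 5 * base + + 3 * sum5 steps) - (+ 4 * base + + 3 * sum5 steps) + + 3 * steps k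
    ≡⟨ identity₂ base (sum5 steps) (steps k) ⟩
      base + + 3 * steps k
    ≡⟨ split k ⟨
      e k
    ∎
    where
    identity₁ : ∀ a s q t →
      + 3 * ((+ 2 * a + s - q) + t) - (+ 5 * (+ 2 * a + s - q) + s)
      ≡ q * + 2 - (+ 4 * a + + 3 * s) + + 3 * t
    identity₁ = solve-∀
    identity₂ : ∀ a s t → (+ 5 * a + + 3 * s) - (+ 4 * a + + 3 * s) + + 3 * t ≡ a + + 3 * t
    identity₂ = solve-∀

Digit : ℤ → Set
Digit a = a ≡ + 0 ⊎ a ≡ + 1 ⊎ a ≡ + 2

ZeroOrThree : ℤ → Set
ZeroOrThree a = a ≡ + 0 ⊎ a ≡ + 3

digit : ∀ {n} → n ℕ.< 3 → Digit (+ n)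
digit {0} _ = inj₁ refl
digit {1} _ = inj₂ (inj₁ refl)
digit {2} _ = inj₂ (inj₂ refl)
digit {ℕ.suc (ℕ.suc (ℕ.suc _))} (s≤s (s≤s (s≤s ())))

private
  non-multiple : ∀ m n → False (m ∣? n) → ¬ m ∣ n
  non-multiple m n = toWitnessFalse

digit-≡ : ∀ {a b} → Digit a → Digit b → + 3 ∣ a - b → a ≡ b
digit-≡ (inj₁ refl)        (inj₁ refl)        _  = refl
digit-≡ (inj₂ (inj₁ refl)) (inj₂ (inj₁ refl)) _  = refl
digit-≡ (inj₂ (inj₂ refl)) (inj₂ (inj₂ refl)) _  = refl
digit-≡ (inj₁ refl)        (inj₂ (inj₁ refl)) 3∣ = contradiction 3∣ (non-multiple _ _ _)
digit-≡ (inj₁ refl)        (inj₂ (inj₂ refl)) 3∣ = contradiction 3∣ (non-multiple _ _ _)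
digit-≡ (inj₂ (inj₁ refl)) (inj₁ refl)        3∣ = contradiction 3∣ (non-multiple _ _ _)
digit-≡ (inj₂ (inj₁ refl)) (inj₂ (inj₂ refl)) 3∣ = contradiction 3∣ (non-multiple _ _ _)
digit-≡ (inj₂ (inj₂ refl)) (inj₁ refl)        3∣ = contradiction 3∣ (non-multiple _ _ _)
digit-≡ (inj₂ (inj₂ refl)) (inj₂ (inj₁ refl)) 3∣ = contradiction 3∣ (non-multiple _ _ _)

zeroOrThree-∣3 : ∀ {a b} → ZeroOrThree a → ZeroOrThree b → + 3 ∣ a - b
zeroOrThree-∣3 (inj₁ refl) (inj₁ refl) = divides (+ 0) refl
zeroOrThree-∣3 (inj₁ refl) (inj₂ refl) = divides (- + 1) refl
zeroOrThree-∣3 (inj₂ refl) (inj₁ refl) = divides (+ 1) refl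
zeroOrThree-∣3 (inj₂ refl) (inj₂ refl) = divides (+ 0) refl

zeroOrThree-≡ : ∀ {a b} → ZeroOrThree a → ZeroOrThree b → + 2 ∣ a - b → a ≡ b
zeroOrThree-≡ (inj₁ refl) (inj₁ refl) _  = refl
zeroOrThree-≡ (inj₂ refl) (inj₂ refl) _  = refl
zeroOrThree-≡ (inj₁ refl) (inj₂ refl) 2∣ = contradiction 2∣ (non-multiple _ _ _)
zeroOrThree-≡ (inj₂ refl) (inj₁ refl) 2∣ = contradiction 2∣ (non-multiple _ _ _)

reduced-unique : ∀ {d r r'} → Reduced d r → Reduced d r' → FiringEquiv r r' → ∀ k → r k ≡ r' k
reduced-unique {d} {r} {r'} (r-real , r-d , r-digit) (r'-real , r'-d , r'-digit) (w , r∼r') k =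
  cong₂ _,_ (re≡ k) (trans (r-real k) (sym (r'-real k)))
  where
  e : Fin 5 → ℤ
  e k = re (r k) - re (r' k)
  e-fired : Fired (realConfig e)
  e-fired = w , λ k → trans (cong (e k ,_) (sym (cong₂ _-_ (r-real k) (r'-real k)))) (r∼r' k)
  open Balanced (fired-real⇒balanced e-fired)
  off-d : ∀ k → k ≢ d → re (r k) ≡ re (r' k)
  off-d k k≢d = digit-≡ (r-digit k k≢d) (r'-digit k k≢d)
    (subst (+ 3 ∣_) (identity (e k) (e d)) (∣m∣n⇒∣m+n (mod3 k d) (zeroOrThree-∣3 r-d r'-d)))
    where
    identity : ∀ a b → (a - b) + b ≡ a
    identity = solve-∀
  at-d : re (r d) ≡ re (r' d)
  at-d = zeroOrThree-≡ r-d r'-d (subst (+ 2 ∣_) (sum5-supported d e e-off) even)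
    where
    e-off : ∀ k → k ≢ d → e k ≡ + 0
    e-off k k≢d = trans (cong (_- re (r' k)) (off-d k k≢d)) (+-inverseʳ (re (r' k)))
  re≡ : ∀ k → re (r k) ≡ re (r' k)
  re≡ k with k ≟ d
  ... | yes refl = at-d
  ... | no k≢d   = off-d k k≢d

%ℕ-≡⇒∣ : ∀ n .{{_ : NonZero n}} a b → a %ℕ n ≡ b %ℕ n → + n ∣ a - b
%ℕ-≡⇒∣ n a b same = divides (a /ℕ n - b /ℕ n) (begin
    a - b
  ≡⟨ cong₂ _-_ (a≡a%ℕn+[a/ℕn]*n a n) (a≡a%ℕn+[a/ℕn]*n b n) ⟩
    (+ (a %ℕ n) + a /ℕ n * + n) - (+ (b %ℕ n) + b /ℕ n * + n)
  ≡⟨ cong (λ r → (+ (a %ℕ n) + a /ℕ n * + n) - (+ r + b /ℕ n * + n)) same ⟨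
    (+ (a %ℕ n) + a /ℕ n * + n) - (+ (a %ℕ n) + b /ℕ n * + n)
  ≡⟨ identity (+ (a %ℕ n)) (a /ℕ n) (b /ℕ n) (+ n) ⟩
    (a /ℕ n - b /ℕ n) * + n
  ∎)
  where
  open ≡-Reasoning
  identity : ∀ r p q n → (r + p * n) - (r + q * n) ≡ (p - q) * n
  identity = solve-∀

%ℕ2-≢⇒∣ : ∀ a b → a %ℕ 2 ≢ b %ℕ 2 → + 2 ∣ (a + + 3) - b
%ℕ2-≢⇒∣ a b differ = subst (+ 2 ∣_) (sym decompose)
  (∣m∣n⇒∣m+n (odd-gap (n%ℕd<d a 2) (n%ℕd<d b 2) differ) (divides (a /ℕ 2 - b /ℕ 2) refl))
  where
  odd-gap : ∀ {r s} → r ℕ.< 2 → s ℕ.< 2 → r ≢ s → + 2 ∣ + r + + 3 - + s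
  odd-gap {0} {0} _ _ r≢s = contradiction refl r≢s
  odd-gap {0} {1} _ _ _   = divides (+ 1) refl
  odd-gap {1} {0} _ _ _   = divides (+ 2) refl
  odd-gap {1} {1} _ _ r≢s = contradiction refl r≢s
  odd-gap {ℕ.suc (ℕ.suc _)} (s≤s (s≤s ())) _ _
  odd-gap {_} {ℕ.suc (ℕ.suc _)} _ (s≤s (s≤s ())) _
  decompose : (a + + 3) - b ≡ (+ (a %ℕ 2) + + 3 - + (b %ℕ 2)) + (a /ℕ 2 - b /ℕ 2) * + 2
  decompose = begin
      (a + + 3) - b
    ≡⟨ cong₂ (λ a b → (a + + 3) - b) (a≡a%ℕn+[a/ℕn]*n a 2) (a≡a%ℕn+[a/ℕn]*n b 2) ⟩
      (+ (a %ℕ 2) + a /ℕ 2 * + 2 + + 3) - (+ (b %ℕ 2) + b /ℕ 2 * + 2)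
    ≡⟨ identity (+ (a %ℕ 2)) (+ (b %ℕ 2)) (a /ℕ 2) (b /ℕ 2) ⟩
      (+ (a %ℕ 2) + + 3 - + (b %ℕ 2)) + (a /ℕ 2 - b /ℕ 2) * + 2
    ∎
    where
    open ≡-Reasoning
    identity : ∀ r s p q → (r + p * + 2 + + 3) - (s + q * + 2) ≡ (r + + 3 - s) + (p - q) * + 2
    identity = solve-∀

parity-correction : ∀ a b c → (c ≡ + 0 × a %ℕ 2 ≡ b %ℕ 2) ⊎ (c ≡ + 1 × a %ℕ 2 ≢ b %ℕ 2) →
                    + 2 ∣ (a + + 3 * c) - b
parity-correction a b _ (inj₁ (refl , same))   =
  subst (λ t → + 2 ∣ t - b) (sym (+-identityʳ a)) (%ℕ-≡⇒∣ 2 a b same)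
parity-correction a b _ (inj₂ (refl , differ)) = %ℕ2-≢⇒∣ a b differ

-- The quantities of the where-block of `algorithm`; carry k is 1 exactly when step (8) adds 3 chips at k.
module Algorithm (d : Fin 5) (z : Config) where

  x : Fin 5 → ℤ
  x = realify z

  remainder : Fin 5 → ℕ
  remainder k = (x k - x d) %ℕ 3

  parityX parityR : ℕ
  parityX = sum5 x %ℕ 2
  parityR = sum5 (λ k → + remainder k) %ℕ 2

  carry : Fin 5 → ℤ
  carry k with parityR ℕ.≟ parityX | k ≟ d
  ... | no _ | yes _ = + 1
  ... | _    | _     = + 0

  output-re : ∀ k → re (algorithm d z k) ≡ + remainder k + + 3 * carry k
  output-re k with parityR ℕ.≟ parityX | k ≟ d
  ... | no _  | yes _ = refl
  ... | yes _ | _     = sym (+-identityʳ _)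
  ... | no _  | no _  = sym (+-identityʳ _)

  carry-off : ∀ k → k ≢ d → carry k ≡ + 0
  carry-off k k≢d with parityR ℕ.≟ parityX | k ≟ d
  ... | yes _ | _       = refl
  ... | no _  | yes k≡d = contradiction k≡d k≢d
  ... | no _  | no _    = refl

  carry-d : (carry d ≡ + 0 × parityR ≡ parityX) ⊎ (carry d ≡ + 1 × parityR ≢ parityX)
  carry-d with parityR ℕ.≟ parityX | d ≟ d
  ... | yes same   | _       = inj₁ (refl , same)
  ... | no  differ | yes _   = inj₂ (refl , differ)
  ... | no  _      | no d≢d = contradiction refl d≢d

  remainder-d : remainder d ≡ 0
  remainder-d = cong (_%ℕ 3) (+-inverseʳ (x d))

  algorithm-reduced : Reduced d (algorithm d z)
  algorithm-reduced = (λ _ → refl) , at-d , off-d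
    where
    at-d : ZeroOrThree (re (algorithm d z d))
    at-d with carry-d
    ... | inj₁ (c≡0 , _) = inj₁ (trans (output-re d) (cong₂ (λ r c → + r + + 3 * c) remainder-d c≡0))
    ... | inj₂ (c≡1 , _) = inj₂ (trans (output-re d) (cong₂ (λ r c → + r + + 3 * c) remainder-d c≡1))
    off-d : ∀ k → k ≢ d → Digit (re (algorithm d z k))
    off-d k k≢d = subst Digit (sym output≡remainder) (digit (n%ℕd<d (x k - x d) 3))
      where
      output≡remainder : re (algorithm d z k) ≡ + remainder k
      output≡remainder = trans (output-re k)
        (trans (cong (λ c → + remainder k + + 3 * c) (carry-off k k≢d)) (+-identityʳ _))

  output-sum : sum5 (λ k → re (algorithm d z k) - x k)
             ≡ (sum5 (λ k → + remainder k) + + 3 * carry d) - sum5 x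
  output-sum = begin
      sum5 (λ k → re (algorithm d z k) - x k)
    ≡⟨ sum5-cong (λ k → cong (_- x k) (output-re k)) ⟩
      sum5 (λ k → (+ remainder k + + 3 * carry k) - x k)
    ≡⟨ sum5-- (λ k → + remainder k + + 3 * carry k) x ⟩
      sum5 (λ k → + remainder k + + 3 * carry k) - sum5 x
    ≡⟨ cong (_- sum5 x) (sum5-+ (λ k → + remainder k) (λ k → + 3 * carry k)) ⟩
      (sum5 (λ k → + remainder k) + sum5 (λ k → + 3 * carry k)) - sum5 x
    ≡⟨ cong (λ s → (sum5 (λ k → + remainder k) + s) - sum5 x)
            (trans (sum5-* (+ 3) carry) (cong (+ 3 *_) (sum5-supported d carry carry-off))) ⟩
      (sum5 (λ k → + remainder k) + + 3 * carry d) - sum5 x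
    ∎
    where open ≡-Reasoning

  output-balanced : Balanced (λ k → re (algorithm d z k) - x k)
  output-balanced = record
    { base  = - x d
    ; steps = λ k → carry k - (x k - x d) /ℕ 3
    ; split = split
    ; even  = subst (+ 2 ∣_) (sym output-sum)
                (parity-correction (sum5 (λ k → + remainder k)) (sum5 x) (carry d) carry-d)
    }
    where
    open ≡-Reasoning
    split : ∀ k → re (algorithm d z k) - x k ≡ - x d + + 3 * (carry k - (x k - x d) /ℕ 3)
    split k = begin
        re (algorithm d z k) - x k
      ≡⟨ cong (_- x k) (output-re k) ⟩
        (+ remainder k + + 3 * carry k) - x k
      ≡⟨ identity₁ (+ remainder k + + 3 * carry k) (x k) (x d) ⟩
        (+ remainder k + + 3 * carry k) - x d - (x k - x d)
      ≡⟨ cong (λ y → (+ remainder k + + 3 * carry k) - x d - y)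
              (a≡a%ℕn+[a/ℕn]*n (x k - x d) 3) ⟩
        (+ remainder k + + 3 * carry k) - x d - (+ remainder k + (x k - x d) /ℕ 3 * + 3)
      ≡⟨ identity₂ (+ remainder k) (carry k) (x d) ((x k - x d) /ℕ 3) ⟩
        - x d + + 3 * (carry k - (x k - x d) /ℕ 3)
      ∎
      where
      identity₁ : ∀ a xk xd → a - xk ≡ a - xd - (xk - xd)
      identity₁ = solve-∀
      identity₂ : ∀ r c xd q → (r + + 3 * c) - xd - (r + q * + 3) ≡ - xd + + 3 * (c - q)
      identity₂ = solve-∀

  algorithm-∼ : FiringEquiv (algorithm d z) z
  algorithm-∼ = FiringEquiv-euclidean {algorithm d z} {z} {realConfig x}
    (balanced⇒fired-real output-balanced)
    ((λ j → (+ 0 , im (z j))) , λ k → sym (applyK-imaginary z k))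

mainTheorem7 : (d : Fin 5) (z : Config) →
    FiringEquiv (algorithm d z) z ×
    Reduced d (algorithm d z) ×
    ((r : Config) → FiringEquiv r z → Reduced d r → ∀ k → r k ≡ algorithm d z k)
mainTheorem7 d z = algorithm-∼ , algorithm-reduced , unique
  where
  open Algorithm d z
  unique : (r : Config) → FiringEquiv r z → Reduced d r → ∀ k → r k ≡ algorithm d z k
  unique r r∼z r-reduced =
    reduced-unique r-reduced algorithm-reduced
                   (FiringEquiv-euclidean {r} {algorithm d z} {z} r∼z algorithm-∼)
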